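{- Let $\mathcal{A}$ be a complementary alphabet and $P$ a word of length $2n$ in $\mathcal{A}$ having at least one $P$-valid plane tree. For a $P$-valid plane tree $T$ the following are equivalent: (i) $T$ is the unique sink of the directed graph $\mathcal{G}_P^+$; (ii) $T$ is the plane tree produced by the greedy algorithm on $P$; (iii) $T$ has minimum total distance $d_T=\sum_{v\in T}\mathrm{dist}(v,v_0)$ among all $P$-valid plane trees, where $v_0$ is the root of $T$.
   Context: A complementary alphabet $\mathcal{A}$ is a finite set in which every letter $B$ has a unique complement $\overline{B}\in\mathcal{A}$, with $\overline{B}\neq B$ and $\overline{\overline{B}}=B$. A plane tree is a rooted tree in which the children of each vertex are linearly ordered. For a plane tree with $n$ edges, label the $2n$ half-edges $1,\dots,2n$ by starting on the left side of the leftmost edge at the root and walking counterclockwise; each edge is $e(i,j)$, $i<j$, with $i,j$ the labels of its sides. For $P=p_1\cdots p_{2n}$, a plane tree with $n$ edges is $P$-valid if $p_i,p_j$ are complements for every edge $e(i,j)$. Local moves, for $i<j<i'<j'$: type 1: if $e(i,j)$, $e(i',j')$ are edges sharing a vertex, replace them by $e(i,j')$, $e(j,i')$; type 2: if $e(i,j')$, $e(j,i')$ are edges sharing a vertex, replace them by $e(i,j)$, $e(i',j')$. A local move on a $P$-valid tree is valid if the result is $P$-valid. $\mathcal{G}_P^+$ is the directed graph whose vertices are the $P$-valid plane trees with a directed edge $T\to T'$ whenever a valid type 2 local move takes $T$ to $T'$. Greedy algorithm: process positions $i=1,\dots,2n$ in order; at $i$, let $j_i<i$ be the largest currently unmatched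 position; if $p_i,p_{j_i}$ are complements, match them (edge $e(j_i,i)$), otherwise leave $i$ unmatched. $\mathrm{dist}$ denotes graph distance in the tree. -}

module Defs where

open import Data.Nat using (ℕ; zero; suc; _+_; _*_; _<_; _≤_)
open import Data.List using (List; []; _∷_; _++_; [_]; length; map)
open import Data.List.Membership.Propositional using (_∈_)
open import Data.Maybe using (Maybe; just; nothing)
open import Data.Product using (Σ; ∃; ∃-syntax; _×_; _,_; proj₁; proj₂)
open import Data.Sum using (_⊎_)
open import Data.Empty using (⊥)
open import Relation.Nullary using (¬_; Dec; yes; no)
open import Relation.Binary.Definitions using (DecidableEquality)
open import Relation.Binary.PropositionalEquality using (_≡_; _≢_)

record ComplementaryAlphabet : Set₁ where
  field
    Carrier   : Set
    _≟_       : DecidableEquality Carrier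
    -- finiteness: an explicit enumeration of all letters
    enum      : List Carrier
    complete  : ∀ x → x ∈ enum
    comp      : Carrier → Carrier
    comp-≢    : ∀ x → comp x ≢ x
    comp-invol : ∀ x → comp (comp x) ≡ x

module _ (𝒜 : ComplementaryAlphabet) where
  open ComplementaryAlphabet 𝒜

  -- 1-based lookup in a word
  at : List Carrier → ℕ → Maybe Carrier
  at []       _             = nothing
  at (x ∷ xs) zero          = nothing
  at (x ∷ xs) (suc zero)    = just x
  at (x ∷ xs) (suc (suc k)) = at xs (suc k)

  Compl : Maybe Carrier → Maybe Carrier → Set
  Compl (just x) (just y) = y ≡ comp x
  Compl _        _        = ⊥

  compl? : (x y : Carrier) → Dec (y ≡ comp x)
  compl? x y = y ≟ comp x

data Tree : Set where
  node : List Tree → Tree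

-- Vertices are identified by their address (path of child indices).
Vertex : Set
Vertex = List ℕ

-- An edge e(lo,hi) with the two labels of its sides and its endpoints.
record Edge : Set where
  constructor edge
  field
    lo hi : ℕ
    top bot : Vertex

-- Labelling of half-edges 1..2n by the counterclockwise contour walk
-- starting on the left side of the leftmost edge at the root:
-- edgesT p s t = (edges of the subtree t hanging at vertex p, labels
-- starting from s ; next free label).
mutual
  edgesT : Vertex → ℕ → Tree → List Edge × ℕ
  edgesT p s (node ts) = edgesF p 0 s ts

  edgesF : Vertex → ℕ → ℕ → List Tree → List Edge × ℕ
  edgesF p k s [] = [] , s
  edgesF p k s (t ∷ ts) with edgesT (p ++ [ k ]) (suc s) t
  ... | es , s' with edgesF p (suc k) (suc s') ts
  ...   | es₂ , s'' = (edge s s' p (p ++ [ k ]) ∷ es ++ es₂) , s''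

edges : Tree → List Edge
edges t = proj₁ (edgesT [] 1 t)

pairs : Tree → List (ℕ × ℕ)
pairs t = map (λ e → Edge.lo e , Edge.hi e) (edges t)

numEdges : Tree → ℕ
numEdges t = length (edges t)

SharesVertex : Edge → Edge → Set
SharesVertex e f =
  (Edge.top e ≡ Edge.top f) ⊎ (Edge.top e ≡ Edge.bot f) ⊎
  (Edge.bot e ≡ Edge.top f) ⊎ (Edge.bot e ≡ Edge.bot f)

mutual
  distSum : ℕ → Tree → ℕ
  distSum d (node ts) = d + distSumF (suc d) ts

  distSumF : ℕ → List Tree → ℕ
  distSumF d []       = 0
  distSumF d (t ∷ ts) = distSum d t + distSumF d ts

totalDist : Tree → ℕ
totalDist t = distSum 0 t

module _ (𝒜 : ComplementaryAlphabet) where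
  open ComplementaryAlphabet 𝒜

  Valid : (n : ℕ) → List Carrier → Tree → Set
  Valid n P T =
    (numEdges T ≡ n) ×
    (∀ e → e ∈ edges T → Compl 𝒜 (at 𝒜 P (Edge.lo e)) (at 𝒜 P (Edge.hi e)))

  -- directed edge T → T' of G_P^+ : a valid type 2 local move.
  Move₂ : (n : ℕ) → List Carrier → Tree → Tree → Set
  Move₂ n P T T' =
    Valid n P T × Valid n P T' ×
    Σ Edge λ e₁ → Σ Edge λ e₂ →
    Σ ℕ λ i → Σ ℕ λ j → Σ ℕ λ i' → Σ ℕ λ j' →
      (i < j) × (j < i') × (i' < j') ×
      e₁ ∈ edges T × e₂ ∈ edges T ×
      (Edge.lo e₁ ≡ i) × (Edge.hi e₁ ≡ j') ×
      (Edge.lo e₂ ≡ j) × (Edge.hi e₂ ≡ i') ×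
      SharesVertex e₁ e₂ ×
      (∀ x → (x ∈ pairs T' →
                 ((x ∈ pairs T × x ≢ (i , j') × x ≢ (j , i'))
                   ⊎ x ≡ (i , j) ⊎ x ≡ (i' , j')))
           × (((x ∈ pairs T × x ≢ (i , j') × x ≢ (j , i'))
                   ⊎ x ≡ (i , j) ⊎ x ≡ (i' , j')) → x ∈ pairs T'))

  IsSink : (n : ℕ) → List Carrier → Tree → Set
  IsSink n P T = Valid n P T × (∀ T' → ¬ Move₂ n P T T')

  IsUniqueSink : (n : ℕ) → List Carrier → Tree → Set
  IsUniqueSink n P T = IsSink n P T × (∀ T' → IsSink n P T' → T' ≡ T)

  -- The stack holds the currently unmatched positions,
  -- largest on top.  greedyFrom P i stack processes positions i, i+1, ...
  -- of the remaining word and returns the list of matched pairs (j_i , i).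
  greedyFrom : List Carrier → List Carrier → ℕ → List ℕ → List (ℕ × ℕ)
  greedyFrom P []       i stack = []
  greedyFrom P (x ∷ xs) i [] = greedyFrom P xs (suc i) (i ∷ [])
  greedyFrom P (x ∷ xs) i (j ∷ stack) with at 𝒜 P j
  ... | nothing = greedyFrom P xs (suc i) (i ∷ j ∷ stack)
  ... | just y with compl? 𝒜 y x
  ...   | yes _ = (j , i) ∷ greedyFrom P xs (suc i) stack
  ...   | no  _ = greedyFrom P xs (suc i) (i ∷ j ∷ stack)

  greedy : List Carrier → List (ℕ × ℕ)
  greedy P = greedyFrom P P 1 []

  IsGreedyTree : List Carrier → Tree → Set
  IsGreedyTree P T = ∀ x → (x ∈ pairs T → x ∈ greedy P) × (x ∈ greedy P → x ∈ pairs T)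

  IsMinDist : (n : ℕ) → List Carrier → Tree → Set
  IsMinDist n P T = ∀ T' → Valid n P T' → totalDist T ≤ totalDist T'

-- A plane tree is determined by the label pairs e(i,j) of its edges, which form a
-- non-crossing matching of 1..2n.  Running the greedy algorithm along the contour of
-- a P-valid tree T, either every edge of T is matched exactly when it closes (and then
-- the matching is T), or the greedy algorithm first deviates inside some subtree
-- node (us ++ node ws ∷ vs) whose root edge e(i,j') has a child edge e(j,i') with
-- P_i, P_j complementary.  In the latter case the type 2 move producing e(i,j), e(i',j')
-- is valid and lifts ws by two levels, so it strictly decreases the total distance.
-- Hence a sink, a tree of minimum total distance and the greedy tree all coincide,
-- and a move out of the greedy tree would give a tree of smaller distance.
module Submission where

open import Defs
open import Data.Nat using (ℕ; zero; suc; _+_; _*_; _∸_; _<_; _≤_; z≤n; s≤s)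
open import Data.Nat.Properties
open import Data.Nat.Tactic.RingSolver using (solve-∀)
open import Data.List using (List; []; _∷_; _++_; [_]; length; map; drop)
open import Data.List.Properties
  using (map-++; ++-assoc; length-++; length-map; ++-identityʳ-unique; ++-cancelˡ; ∷-injectiveˡ; drop-[])
open import Data.List.Membership.Propositional using (_∈_)
open import Data.List.Membership.Propositional.Properties using (∈-++⁺ˡ; ∈-++⁺ʳ; ∈-++⁻; ∈-map⁺; ∈-map⁻)
open import Data.List.Relation.Binary.Subset.Propositional using (_⊆_)
open import Data.List.Relation.Unary.Any using (here; there)
open import Data.Maybe using (just; nothing)
open import Data.Product using (Σ; _×_; _,_; proj₁; proj₂)
open import Data.Sum using (_⊎_; inj₁; inj₂; [_,_]′; map₂)
open import Data.Empty using (⊥-elim)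
open import Function.Base using (_∘_)
open import Function.Bundles using (_⇔_; mk⇔)
open import Relation.Nullary using (¬_; yes; no)
open import Relation.Binary.PropositionalEquality hiding ([_])

labels : Edge → ℕ × ℕ
labels e = Edge.lo e , Edge.hi e

-- edgesT and edgesF without the vertex addresses (see edgesT-labels).
mutual
  afterT : ℕ → Tree → ℕ
  afterT s (node ts) = afterF s ts

  afterF : ℕ → List Tree → ℕ
  afterF s []       = s
  afterF s (t ∷ ts) = afterF (suc (afterT (suc s) t)) ts

mutual
  pairsT : ℕ → Tree → List (ℕ × ℕ)
  pairsT s (node ts) = pairsF s ts

  pairsF : ℕ → List Tree → List (ℕ × ℕ)
  pairsF s []       = []
  pairsF s (t ∷ ts) = (s , afterT (suc s) t) ∷ (pairsT (suc s) t ++ pairsF (suc (afterT (suc s) t)) ts)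

mutual
  edgesT-labels : ∀ p s t →
    proj₂ (edgesT p s t) ≡ afterT s t × map labels (proj₁ (edgesT p s t)) ≡ pairsT s t
  edgesT-labels p s (node ts) = edgesF-labels p 0 s ts

  edgesF-labels : ∀ p k s ts →
    proj₂ (edgesF p k s ts) ≡ afterF s ts × map labels (proj₁ (edgesF p k s ts)) ≡ pairsF s ts
  edgesF-labels p k s [] = refl , refl
  edgesF-labels p k s (t ∷ ts)
    with edgesT (p ++ [ k ]) (suc s) t | edgesT-labels (p ++ [ k ]) (suc s) t
  ... | es , .(afterT (suc s) t) | refl , es-labels
    with edgesF p (suc k) (suc (afterT (suc s) t)) ts | edgesF-labels p (suc k) (suc (afterT (suc s) t)) ts
  ...   | es₂ , _ | end-eq , es₂-labels =
    end-eq , cong (_ ∷_) (trans (map-++ labels es es₂) (cong₂ _++_ es-labels es₂-labels))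

pairs-node : ∀ ts → pairs (node ts) ≡ pairsF 1 ts
pairs-node ts = proj₂ (edgesF-labels [] 0 1 ts)

∈-pairs-node⁺ : ∀ {ts x} → x ∈ pairsF 1 ts → x ∈ pairs (node ts)
∈-pairs-node⁺ {ts} {x} = subst (x ∈_) (sym (pairs-node ts))

∈-pairs-node⁻ : ∀ {ts x} → x ∈ pairs (node ts) → x ∈ pairsF 1 ts
∈-pairs-node⁻ {ts} {x} = subst (x ∈_) (pairs-node ts)

afterF-++ : ∀ s xs ys → afterF s (xs ++ ys) ≡ afterF (afterF s xs) ys
afterF-++ s []       ys = refl
afterF-++ s (x ∷ xs) ys = afterF-++ _ xs ys

pairsF-++ : ∀ s xs ys → pairsF s (xs ++ ys) ≡ pairsF s xs ++ pairsF (afterF s xs) ys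
pairsF-++ s []       ys = refl
pairsF-++ s (x ∷ xs) ys = cong ((s , afterT (suc s) x) ∷_)
  (trans (cong (pairsT (suc s) x ++_) (pairsF-++ _ xs ys)) (sym (++-assoc (pairsT (suc s) x) _ _)))

∈-pairsF-++ˡ : ∀ {x} s xs ys → x ∈ pairsF s xs → x ∈ pairsF s (xs ++ ys)
∈-pairsF-++ˡ s xs ys m = subst (_ ∈_) (sym (pairsF-++ s xs ys)) (∈-++⁺ˡ m)

∈-pairsF-++ʳ : ∀ {x} s xs ys → x ∈ pairsF (afterF s xs) ys → x ∈ pairsF s (xs ++ ys)
∈-pairsF-++ʳ s xs ys m = subst (_ ∈_) (sym (pairsF-++ s xs ys)) (∈-++⁺ʳ (pairsF s xs) m)

∈-pairsF-++⁻ : ∀ {x} s xs ys → x ∈ pairsF s (xs ++ ys) → x ∈ pairsF s xs ⊎ x ∈ pairsF (afterF s xs) ys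
∈-pairsF-++⁻ s xs ys m = ∈-++⁻ (pairsF s xs) (subst (_ ∈_) (pairsF-++ s xs ys) m)

∈-pairsF-node∷⁻ : ∀ {x} s cs r → x ∈ pairsF s (node cs ∷ r) →
  x ≡ (s , afterF (suc s) cs) ⊎ x ∈ pairsF (suc s) cs ⊎ x ∈ pairsF (suc (afterF (suc s) cs)) r
∈-pairsF-node∷⁻ s cs r (here e)  = inj₁ e
∈-pairsF-node∷⁻ s cs r (there m) = inj₂ (∈-++⁻ (pairsF (suc s) cs) m)

mutual
  s≤afterT : ∀ s t → s ≤ afterT s t
  s≤afterT s (node cs) = s≤afterF s cs

  s≤afterF : ∀ s ts → s ≤ afterF s ts
  s≤afterF s []       = ≤-refl
  s≤afterF s (t ∷ ts) = ≤-trans (≤-trans (n≤1+n s) (s≤afterT (suc s) t)) (≤-trans (n≤1+n _) (s≤afterF _ ts))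

s<after-node : ∀ s cs → s < suc (afterF (suc s) cs)
s<after-node s cs = s≤s (≤-trans (n≤1+n s) (s≤afterF (suc s) cs))

Inside : ℕ → ℕ → ℕ × ℕ → Set
Inside a b (i , j) = (a ≤ i) × (i < j) × (j < b)

mutual
  pairsT-inside : ∀ s t {x} → x ∈ pairsT s t → Inside s (afterT s t) x
  pairsT-inside s (node cs) m = pairsF-inside s cs m

  pairsF-inside : ∀ s ts {x} → x ∈ pairsF s ts → Inside s (afterF s ts) x
  pairsF-inside s (t ∷ ts) (here refl) = ≤-refl , s≤afterT (suc s) t , s≤afterF _ ts
  pairsF-inside s (t ∷ ts) (there m) with ∈-++⁻ (pairsT (suc s) t) m
  ... | inj₁ m₁ = let (a , b , c) = pairsT-inside (suc s) t m₁ in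
    ≤-trans (n≤1+n s) a , b , ≤-trans c (≤-trans (n≤1+n _) (s≤afterF _ ts))
  ... | inj₂ m₂ = let (a , b , c) = pairsF-inside _ ts m₂ in
    ≤-trans (≤-trans (n≤1+n s) (≤-trans (s≤afterT (suc s) t) (n≤1+n _))) a , b , c

lo<hi : ∀ {a b x} → Inside a b x → proj₁ x < proj₂ x
lo<hi (_ , lt , _) = lt

lo<end : ∀ {a b x} → Inside a b x → proj₁ x < b
lo<end (_ , lt , lt′) = <-trans lt lt′

mutual
  afterT-size : ∀ s t → afterT s t ≡ length (pairsT s t) + length (pairsT s t) + s
  afterT-size s (node cs) = afterF-size s cs

  afterF-size : ∀ s ts → afterF s ts ≡ length (pairsF s ts) + length (pairsF s ts) + s
  afterF-size s [] = refl
  afterF-size s (t ∷ ts) = begin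
      afterF (suc b) ts                        ≡⟨ afterF-size (suc b) ts ⟩
      L₂ + L₂ + suc b                          ≡⟨ cong (λ z → L₂ + L₂ + suc z) (afterT-size (suc s) t) ⟩
      L₂ + L₂ + suc (L₁ + L₁ + suc s)          ≡⟨ regroup s L₁ L₂ ⟩
      suc (L₁ + L₂) + suc (L₁ + L₂) + s        ≡⟨ cong (λ z → suc z + suc z + s) (sym (length-++ (pairsT (suc s) t))) ⟩
      length (pairsF s (t ∷ ts)) + length (pairsF s (t ∷ ts)) + s ∎
    where
      open ≡-Reasoning
      b  = afterT (suc s) t
      L₁ = length (pairsT (suc s) t)
      L₂ = length (pairsF (suc b) ts)
      regroup : ∀ s L₁ L₂ → L₂ + L₂ + suc (L₁ + L₁ + suc s) ≡ suc (L₁ + L₂) + suc (L₁ + L₂) + s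
      regroup = solve-∀

-- A forest is determined by its label pairs

first-edge-≡ : ∀ s cs r cs′ r′ → pairsF s (node cs ∷ r) ⊆ pairsF s (node cs′ ∷ r′) →
  afterF (suc s) cs ≡ afterF (suc s) cs′
first-edge-≡ s cs r cs′ r′ sub with ∈-pairsF-node∷⁻ s cs′ r′ (sub (here refl))
... | inj₁ e          = cong proj₂ e
... | inj₂ (inj₁ m) = ⊥-elim (<⇒≱ (proj₁ (pairsF-inside _ cs′ m)) ≤-refl)
... | inj₂ (inj₂ m) = ⊥-elim (<⇒≱ (s<after-node s cs′) (proj₁ (pairsF-inside _ r′ m)))

children-⊆ : ∀ s cs r cs′ r′ → afterF (suc s) cs ≡ afterF (suc s) cs′ →
  pairsF s (node cs ∷ r) ⊆ pairsF s (node cs′ ∷ r′) → pairsF (suc s) cs ⊆ pairsF (suc s) cs′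
children-⊆ s cs r cs′ r′ eq sub m with ∈-pairsF-node∷⁻ s cs′ r′ (sub (there (∈-++⁺ˡ m)))
... | inj₁ refl      = ⊥-elim (<⇒≱ (proj₁ (pairsF-inside _ cs m)) ≤-refl)
... | inj₂ (inj₁ m₁) = m₁
... | inj₂ (inj₂ m₂) = ⊥-elim (<⇒≱ (lo<end (pairsF-inside _ cs m))
  (≤-trans (≤-trans (≤-reflexive eq) (n≤1+n _)) (proj₁ (pairsF-inside _ r′ m₂))))

siblings-⊆ : ∀ s cs r cs′ r′ → afterF (suc s) cs ≡ afterF (suc s) cs′ →
  pairsF s (node cs ∷ r) ⊆ pairsF s (node cs′ ∷ r′) →
  pairsF (suc (afterF (suc s) cs)) r ⊆ pairsF (suc (afterF (suc s) cs)) r′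
siblings-⊆ s cs r cs′ r′ eq sub {x} m with ∈-pairsF-node∷⁻ s cs′ r′ (sub (there (∈-++⁺ʳ (pairsF (suc s) cs) m)))
... | inj₁ refl      = ⊥-elim (<⇒≱ (s<after-node s cs) (proj₁ (pairsF-inside _ r m)))
... | inj₂ (inj₁ m₁) = ⊥-elim (<⇒≱ (<-≤-trans (lo<end (pairsF-inside _ cs′ m₁))
                                             (≤-trans (≤-reflexive (sym eq)) (n≤1+n _)))
  (proj₁ (pairsF-inside _ r m)))
... | inj₂ (inj₂ m₂) = subst (λ z → x ∈ pairsF (suc z) r′) (sym eq) m₂

pairsF-injective : ∀ s ts ts′ → pairsF s ts ⊆ pairsF s ts′ → pairsF s ts′ ⊆ pairsF s ts → ts ≡ ts′
pairsF-injective s []       []        _ _ = refl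
pairsF-injective s []       (_ ∷ _)   _ sup with sup (here refl)
... | ()
pairsF-injective s (_ ∷ _)  []        sub _ with sub (here refl)
... | ()
pairsF-injective s (node cs ∷ r) (node cs′ ∷ r′) sub sup =
  cong₂ _∷_ (cong node (pairsF-injective (suc s) cs cs′ (children-⊆ s cs r cs′ r′ eq sub)
                                                        (children-⊆ s cs′ r′ cs r (sym eq) sup)))
            (pairsF-injective _ r r′ (siblings-⊆ s cs r cs′ r′ eq sub)
              (λ {x} m → subst (λ z → x ∈ pairsF (suc z) r) (sym eq)
                 (siblings-⊆ s cs′ r′ cs r (sym eq) sup (subst (λ z → x ∈ pairsF (suc z) r′) eq m))))
  where eq = first-edge-≡ s cs r cs′ r′ sub

-- `down ls c rs` puts the hole of c into the children of a node sitting between ls and rs.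
data Context : Set where
  hole : List Tree → List Tree → Context
  down : List Tree → Context → List Tree → Context

plug : Context → List Tree → List Tree
plug (hole ls rs)   f = ls ++ f ++ rs
plug (down ls c rs) f = ls ++ node (plug c f) ∷ rs

holeStart : Context → ℕ → ℕ
holeStart (hole ls rs)   s = afterF s ls
holeStart (down ls c rs) s = holeStart c (suc (afterF s ls))

infixr 5 _◂_
_◂_ : Tree → Context → Context
t ◂ hole ls rs   = hole (t ∷ ls) rs
t ◂ down ls c rs = down (t ∷ ls) c rs

plug-◂ : ∀ t C f → plug (t ◂ C) f ≡ t ∷ plug C f
plug-◂ t (hole ls rs)   f = refl
plug-◂ t (down ls c rs) f = refl

holeStart-◂ : ∀ t C s → holeStart (t ◂ C) s ≡ holeStart C (suc (afterT (suc s) t))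
holeStart-◂ t (hole ls rs)   s = refl
holeStart-◂ t (down ls c rs) s = refl

s≤holeStart : ∀ C s → s ≤ holeStart C s
s≤holeStart (hole ls rs)   s = s≤afterF s ls
s≤holeStart (down ls c rs) s = ≤-trans (≤-trans (s≤afterF s ls) (n≤1+n _)) (s≤holeStart c _)

afterF-plug : ∀ C s f₁ f₂ → afterF (holeStart C s) f₁ ≡ afterF (holeStart C s) f₂ →
  afterF s (plug C f₁) ≡ afterF s (plug C f₂)
afterF-plug (hole ls rs) s f₁ f₂ eq = begin
  afterF s (ls ++ f₁ ++ rs)              ≡⟨ afterF-++ s ls (f₁ ++ rs) ⟩
  afterF (afterF s ls) (f₁ ++ rs)        ≡⟨ afterF-++ _ f₁ rs ⟩
  afterF (afterF (afterF s ls) f₁) rs    ≡⟨ cong (λ z → afterF z rs) eq ⟩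
  afterF (afterF (afterF s ls) f₂) rs    ≡⟨ afterF-++ _ f₂ rs ⟨
  afterF (afterF s ls) (f₂ ++ rs)        ≡⟨ afterF-++ s ls (f₂ ++ rs) ⟨
  afterF s (ls ++ f₂ ++ rs)              ∎
  where open ≡-Reasoning
afterF-plug (down ls c rs) s f₁ f₂ eq = begin
  afterF s (ls ++ node (plug c f₁) ∷ rs)                  ≡⟨ afterF-++ s ls _ ⟩
  afterF (suc (afterF (suc (afterF s ls)) (plug c f₁))) rs ≡⟨ cong (λ z → afterF (suc z) rs) (afterF-plug c _ f₁ f₂ eq) ⟩
  afterF (suc (afterF (suc (afterF s ls)) (plug c f₂))) rs ≡⟨ afterF-++ s ls _ ⟨
  afterF s (ls ++ node (plug c f₂) ∷ rs)                  ∎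
  where open ≡-Reasoning

afterF-hole≤afterF-plug : ∀ C s f → afterF (holeStart C s) f ≤ afterF s (plug C f)
afterF-hole≤afterF-plug (hole ls rs) s f =
  ≤-trans (s≤afterF _ rs) (≤-reflexive (sym (trans (afterF-++ s ls (f ++ rs)) (afterF-++ _ f rs))))
afterF-hole≤afterF-plug (down ls c rs) s f =
  ≤-trans (afterF-hole≤afterF-plug c _ f)
    (≤-trans (n≤1+n _) (≤-trans (s≤afterF _ rs) (≤-reflexive (sym (afterF-++ s ls _)))))

pairsF-hole⊆pairsF-plug : ∀ C s f → pairsF (holeStart C s) f ⊆ pairsF s (plug C f)
pairsF-hole⊆pairsF-plug (hole ls rs)   s f m = ∈-pairsF-++ʳ s ls (f ++ rs) (∈-pairsF-++ˡ _ f rs m)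
pairsF-hole⊆pairsF-plug (down ls c rs) s f m =
  ∈-pairsF-++ʳ s ls _ (there (∈-++⁺ˡ (pairsF-hole⊆pairsF-plug c _ f m)))

-- A pair of plug C f₁ outside the hole survives refilling the hole with any f₂ spanning
-- the same labels, and starts before or after the hole's interval.
OutsideHole : Context → ℕ → List Tree → List Tree → ℕ × ℕ → Set
OutsideHole C s f₁ f₂ x =
  x ∈ pairsF s (plug C f₂) × (proj₁ x < holeStart C s ⊎ afterF (holeStart C s) f₁ ≤ proj₁ x)

∈-pairsF-plug⁻ : ∀ C s f₁ f₂ → afterF (holeStart C s) f₁ ≡ afterF (holeStart C s) f₂ →
  ∀ {x} → x ∈ pairsF s (plug C f₁) → x ∈ pairsF (holeStart C s) f₁ ⊎ OutsideHole C s f₁ f₂ x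
∈-pairsF-plug⁻ (hole ls rs) s f₁ f₂ eq {x} m with ∈-pairsF-++⁻ s ls (f₁ ++ rs) m
... | inj₁ m₁ = inj₂ (∈-pairsF-++ˡ s ls _ m₁ , inj₁ (<-≤-trans (lo<hi (pairsF-inside s ls m₁))
                                                    (<⇒≤ (proj₂ (proj₂ (pairsF-inside s ls m₁))))))
... | inj₂ m₂ with ∈-pairsF-++⁻ _ f₁ rs m₂
...   | inj₁ m₃ = inj₁ m₃
...   | inj₂ m₄ = inj₂ (∈-pairsF-++ʳ s ls _ (∈-pairsF-++ʳ _ f₂ rs (subst (λ z → x ∈ pairsF z rs) eq m₄)) ,
                        inj₂ (proj₁ (pairsF-inside _ rs m₄)))
∈-pairsF-plug⁻ (down ls c rs) s f₁ f₂ eq {x} m with ∈-pairsF-++⁻ s ls _ m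
... | inj₁ m₁ = inj₂ (∈-pairsF-++ˡ s ls _ m₁ ,
                      inj₁ (<-≤-trans (lo<end (pairsF-inside s ls m₁)) (≤-trans (n≤1+n _) (s≤holeStart c _))))
... | inj₂ (here refl) =
  inj₂ (∈-pairsF-++ʳ s ls _ (here (cong (afterF s ls ,_) (afterF-plug c _ f₁ f₂ eq))) , inj₁ (s≤holeStart c _))
... | inj₂ (there m₂) with ∈-++⁻ (pairsF _ (plug c f₁)) m₂
...   | inj₁ m₃ with ∈-pairsF-plug⁻ c _ f₁ f₂ eq m₃
...     | inj₁ m₅       = inj₁ m₅
...     | inj₂ (m₅ , r) = inj₂ (∈-pairsF-++ʳ s ls _ (there (∈-++⁺ˡ m₅)) , r)
∈-pairsF-plug⁻ (down ls c rs) s f₁ f₂ eq {x} m | inj₂ (there m₂) | inj₂ m₄ =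
  inj₂ (∈-pairsF-++ʳ s ls _ (there (∈-++⁺ʳ (pairsF _ (plug c f₂))
          (subst (λ z → x ∈ pairsF (suc z) rs) (afterF-plug c _ f₁ f₂ eq) m₄))) ,
        inj₂ (≤-trans (afterF-hole≤afterF-plug c _ f₁) (≤-trans (n≤1+n _) (proj₁ (pairsF-inside _ rs m₄)))))

double-injective : ∀ a b → a + a ≡ b + b → a ≡ b
double-injective zero    zero    e = refl
double-injective (suc a) (suc b) e =
  cong suc (double-injective a b (suc-injective (trans (sym (+-suc a a)) (trans (suc-injective e) (+-suc b b)))))

length-pairsF-plug : ∀ C f₁ f₂ → afterF (holeStart C 1) f₁ ≡ afterF (holeStart C 1) f₂ →
  length (pairsF 1 (plug C f₂)) ≡ length (pairsF 1 (plug C f₁))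
length-pairsF-plug C f₁ f₂ eq = double-injective _ _ (+-cancelʳ-≡ 1 _ _
  (trans (sym (afterF-size 1 (plug C f₂))) (trans (sym (afterF-plug C 1 f₁ f₂ eq)) (afterF-size 1 (plug C f₁)))))

distSumF-++ : ∀ d xs ys → distSumF d (xs ++ ys) ≡ distSumF d xs + distSumF d ys
distSumF-++ d []       ys = refl
distSumF-++ d (x ∷ xs) ys = trans (cong (distSum d x +_) (distSumF-++ d xs ys)) (sym (+-assoc (distSum d x) _ _))

mutual
  distSum-monoˡ : ∀ d t → distSum d t ≤ distSum (suc d) t
  distSum-monoˡ d (node cs) = +-mono-≤ (n≤1+n d) (distSumF-monoˡ (suc d) cs)

  distSumF-monoˡ : ∀ d ts → distSumF d ts ≤ distSumF (suc d) ts
  distSumF-monoˡ d []       = ≤-refl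
  distSumF-monoˡ d (t ∷ ts) = +-mono-≤ (distSum-monoˡ d t) (distSumF-monoˡ d ts)

distSumF-plug-< : ∀ C f₁ f₂ → (∀ d → distSumF d f₂ < distSumF d f₁) →
  ∀ d → distSumF d (plug C f₂) < distSumF d (plug C f₁)
distSumF-plug-< (hole ls rs) f₁ f₂ lt d
  rewrite distSumF-++ d ls (f₂ ++ rs) | distSumF-++ d ls (f₁ ++ rs) | distSumF-++ d f₂ rs | distSumF-++ d f₁ rs =
  +-monoʳ-< (distSumF d ls) (+-monoˡ-< (distSumF d rs) (lt d))
distSumF-plug-< (down ls c rs) f₁ f₂ lt d
  rewrite distSumF-++ d ls (node (plug c f₂) ∷ rs) | distSumF-++ d ls (node (plug c f₁) ∷ rs) =
  +-monoʳ-< (distSumF d ls) (+-monoˡ-< (distSumF d rs) (+-monoʳ-< d (distSumF-plug-< c f₁ f₂ lt (suc d))))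

lift-rearrange : ∀ d U W V → (d + (U + ((suc d + W) + V))) + 0 ≡ suc ((d + U) + (W + ((d + V) + 0)))
lift-rearrange = solve-∀

-- The subtrees ws rise by two levels while us and vs keep their depth.
distSumF-lift-< : ∀ us ws vs d →
  distSumF d (node us ∷ ws ++ node vs ∷ []) < distSumF d (node (us ++ node ws ∷ vs) ∷ [])
distSumF-lift-< us ws vs d
  rewrite distSumF-++ d ws (node vs ∷ []) | distSumF-++ (suc d) us (node ws ∷ vs)
        | lift-rearrange d (distSumF (suc d) us) (distSumF (suc (suc d)) ws) (distSumF (suc d) vs) =
  s≤s (+-monoʳ-≤ (d + distSumF (suc d) us) (+-monoˡ-≤ ((d + distSumF (suc d) vs) + 0)
        (≤-trans (distSumF-monoˡ d ws) (distSumF-monoˡ (suc d) ws))))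

edgesAt : Vertex → ℕ → ℕ → List Tree → List Edge
edgesAt p k s ts = proj₁ (edgesF p k s ts)

edgesF-∷ : ∀ p k s t ts → edgesAt p k s (t ∷ ts) ≡
  edge s (afterT (suc s) t) p (p ++ [ k ]) ∷ (proj₁ (edgesT (p ++ [ k ]) (suc s) t) ++ edgesAt p (suc k) (suc (afterT (suc s) t)) ts)
edgesF-∷ p k s t ts with edgesT (p ++ [ k ]) (suc s) t | edgesT-labels (p ++ [ k ]) (suc s) t
... | es , .(afterT (suc s) t) | refl , _ = refl

labels∈pairsF : ∀ {e} p k s ts → e ∈ edgesAt p k s ts → labels e ∈ pairsF s ts
labels∈pairsF {e} p k s ts m = subst (labels e ∈_) (proj₂ (edgesF-labels p k s ts)) (∈-map⁺ labels m)

∈-edgesF-node∷⁻ : ∀ {e} p k s cs r → e ∈ edgesAt p k s (node cs ∷ r) →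
  e ≡ edge s (afterF (suc s) cs) p (p ++ [ k ]) ⊎ e ∈ edgesAt (p ++ [ k ]) 0 (suc s) cs ⊎
  e ∈ edgesAt p (suc k) (suc (afterF (suc s) cs)) r
∈-edgesF-node∷⁻ {e} p k s cs r m with subst (e ∈_) (edgesF-∷ p k s (node cs) r) m
... | here eq   = inj₁ eq
... | there m₂ = inj₂ (∈-++⁻ (edgesAt (p ++ [ k ]) 0 (suc s) cs) m₂)

∈-edgesF-head : ∀ p k s cs r → edge s (afterF (suc s) cs) p (p ++ [ k ]) ∈ edgesAt p k s (node cs ∷ r)
∈-edgesF-head p k s cs r = subst (edge s (afterF (suc s) cs) p (p ++ [ k ]) ∈_) (sym (edgesF-∷ p k s (node cs) r)) (here refl)

∈-edgesF-child : ∀ {e} p k s cs r → e ∈ edgesAt (p ++ [ k ]) 0 (suc s) cs → e ∈ edgesAt p k s (node cs ∷ r)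
∈-edgesF-child {e} p k s cs r m = subst (e ∈_) (sym (edgesF-∷ p k s (node cs) r)) (there (∈-++⁺ˡ m))

∈-edgesF-++ˡ : ∀ {e} p k s xs ys → e ∈ edgesAt p k s xs → e ∈ edgesAt p k s (xs ++ ys)
∈-edgesF-++ˡ {e} p k s (t ∷ xs) ys m with subst (e ∈_) (edgesF-∷ p k s t xs) m
... | here eq = subst (e ∈_) (sym (edgesF-∷ p k s t (xs ++ ys))) (here eq)
... | there m₂ with ∈-++⁻ (proj₁ (edgesT (p ++ [ k ]) (suc s) t)) m₂
...   | inj₁ m₃ = subst (e ∈_) (sym (edgesF-∷ p k s t (xs ++ ys))) (there (∈-++⁺ˡ m₃))
...   | inj₂ m₄ = subst (e ∈_) (sym (edgesF-∷ p k s t (xs ++ ys)))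
                    (there (∈-++⁺ʳ (proj₁ (edgesT (p ++ [ k ]) (suc s) t)) (∈-edgesF-++ˡ p (suc k) _ xs ys m₄)))

∈-edgesF-++ʳ : ∀ {e} p k s xs ys → e ∈ edgesAt p (k + length xs) (afterF s xs) ys → e ∈ edgesAt p k s (xs ++ ys)
∈-edgesF-++ʳ {e} p k s [] ys m = subst (λ z → e ∈ edgesAt p z s ys) (+-identityʳ k) m
∈-edgesF-++ʳ {e} p k s (t ∷ xs) ys m =
  subst (e ∈_) (sym (edgesF-∷ p k s t (xs ++ ys)))
    (there (∈-++⁺ʳ (proj₁ (edgesT (p ++ [ k ]) (suc s) t))
      (∈-edgesF-++ʳ p (suc k) _ xs ys
        (subst (λ z → e ∈ edgesAt p z (afterF (suc (afterT (suc s) t)) xs) ys) (+-suc k (length xs)) m))))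

-- The vertex address of the hole's parent and the child index at which the hole begins.
holeAddress : Context → Vertex → ℕ → Vertex × ℕ
holeAddress (hole ls rs)   p k = p , k + length ls
holeAddress (down ls c rs) p k = holeAddress c (p ++ [ k + length ls ]) 0

edgesF-hole⊆edgesF-plug : ∀ C p k s f →
  edgesAt (proj₁ (holeAddress C p k)) (proj₂ (holeAddress C p k)) (holeStart C s) f ⊆ edgesAt p k s (plug C f)
edgesF-hole⊆edgesF-plug (hole ls rs)   p k s f m = ∈-edgesF-++ʳ p k s ls (f ++ rs) (∈-edgesF-++ˡ p _ _ f rs m)
edgesF-hole⊆edgesF-plug (down ls c rs) p k s f m =
  ∈-edgesF-++ʳ p k s ls _ (∈-edgesF-child p _ _ (plug c f) rs (edgesF-hole⊆edgesF-plug c _ 0 _ f m))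

Below : Vertex → ℕ → Vertex → Set
Below p k v = Σ Vertex λ rest → v ≡ p ++ (k ∷ rest)

Below-child : ∀ {p k} → Below p k (p ++ [ k ])
Below-child = [] , refl

Below-≢ : ∀ {p k v} → Below p k v → v ≢ p
Below-≢ {p} (rest , refl) e with ++-identityʳ-unique p (sym e)
... | ()

Below-injective : ∀ {p a b v} → Below p a v → Below p b v → a ≡ b
Below-injective {p} (r₁ , refl) (r₂ , e) = ∷-injectiveˡ (++-cancelˡ p _ _ e)

Below-parent : ∀ {p k k′ v} → Below (p ++ [ k ]) k′ v → Below p k v
Below-parent {p} {k} {k′} (rest , refl) = (k′ ∷ rest) , ++-assoc p [ k ] (k′ ∷ rest)

Below-disjoint : ∀ {p a b v} → a < b → Below p a v → ¬ Below p b v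
Below-disjoint a<b u u′ = <⇒≢ a<b (Below-injective u u′)

mutual
  top-location : ∀ {e} p k s ts → e ∈ edgesAt p k s ts →
    Edge.top e ≡ p ⊎ Σ ℕ λ k′ → (k ≤ k′) × Below p k′ (Edge.top e)
  top-location p k s (node cs ∷ r) m with ∈-edgesF-node∷⁻ p k s cs r m
  ... | inj₁ refl      = inj₁ refl
  ... | inj₂ (inj₁ m₁) = inj₂ (k , ≤-refl , top-in-child p k _ cs m₁)
  ... | inj₂ (inj₂ m₂) with top-location p (suc k) _ r m₂
  ...   | inj₁ e              = inj₁ e
  ...   | inj₂ (k′ , le , u) = inj₂ (k′ , ≤-trans (n≤1+n k) le , u)

  top-in-child : ∀ {e} p k s cs → e ∈ edgesAt (p ++ [ k ]) 0 s cs → Below p k (Edge.top e)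
  top-in-child p k s cs m with top-location (p ++ [ k ]) 0 s cs m
  ... | inj₁ e          = [] , e
  ... | inj₂ (_ , _ , u) = Below-parent u

bot-location : ∀ {e} p k s ts → e ∈ edgesAt p k s ts → Σ ℕ λ k′ → (k ≤ k′) × Below p k′ (Edge.bot e)
bot-location p k s (node cs ∷ r) m with ∈-edgesF-node∷⁻ p k s cs r m
... | inj₁ refl      = k , ≤-refl , Below-child
... | inj₂ (inj₁ m₁) = k , ≤-refl , Below-parent (proj₂ (proj₂ (bot-location (p ++ [ k ]) 0 _ cs m₁)))
... | inj₂ (inj₂ m₂) with bot-location p (suc k) _ r m₂
...   | k′ , le , u = k′ , ≤-trans (n≤1+n k) le , u

bot-in-child : ∀ {e} p k s cs → e ∈ edgesAt (p ++ [ k ]) 0 s cs → Below p k (Edge.bot e)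
bot-in-child p k s cs m = Below-parent (proj₂ (proj₂ (bot-location (p ++ [ k ]) 0 s cs m)))

bot-in-later : ∀ {e} p k s r → e ∈ edgesAt p (suc k) s r → ¬ Below p k (Edge.bot e)
bot-in-later p k s r m u = let (k′ , le , u′) = bot-location p (suc k) s r m in Below-disjoint le u u′

top-in-later : ∀ {e} p k s r → e ∈ edgesAt p (suc k) s r → Edge.top e ≢ p → ¬ Below p k (Edge.top e)
top-in-later p k s r m ≢p u with top-location p (suc k) s r m
... | inj₁ e             = ≢p e
... | inj₂ (k′ , le , u′) = Below-disjoint le u u′

root-edge-lo : ∀ {e} q k s ts → e ∈ edgesAt q k s ts → Edge.top e ≡ q →
  Σ (List Tree) λ us → Σ (List Tree) λ ws → Σ (List Tree) λ vs →
    (ts ≡ us ++ node ws ∷ vs) × (Edge.lo e ≡ afterF s us)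
root-edge-lo q k s (node cs ∷ r) m eq with ∈-edgesF-node∷⁻ q k s cs r m
... | inj₁ refl      = [] , cs , r , refl , refl
... | inj₂ (inj₁ m₁) = ⊥-elim (Below-≢ (top-in-child q k _ cs m₁) eq)
... | inj₂ (inj₂ m₂) with root-edge-lo q (suc k) _ r m₂ eq
...   | us , ws , vs , refl , l = node cs ∷ us , ws , vs , refl , l

-- A subtree node (us ++ node ws ∷ vs) of ts whose parent edge starts at label i and
-- whose child edge into node ws starts at label j.
Nested : List Tree → ℕ → ℕ → ℕ → Set
Nested ts s i j = Σ Context λ C → Σ (List Tree) λ us → Σ (List Tree) λ ws → Σ (List Tree) λ vs →
  (ts ≡ plug C (node (us ++ node ws ∷ vs) ∷ [])) × (i ≡ holeStart C s) × (j ≡ afterF (suc (holeStart C s)) us)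

nested-lo< : ∀ {ts s i j} → Nested ts s i j → i < j
nested-lo< (C , us , _ , _ , _ , refl , refl) = s≤afterF (suc (holeStart C _)) us

nested-◂ : ∀ {ts s i j} t → Nested ts (suc (afterT (suc s) t)) i j → Nested (t ∷ ts) s i j
nested-◂ {s = s} t (C , us , ws , vs , refl , refl , refl) =
  t ◂ C , us , ws , vs , sym (plug-◂ t C _) , sym (holeStart-◂ t C s) ,
  cong (λ z → afterF (suc z) us) (sym (holeStart-◂ t C s))

nested-edges : ∀ {e f} p k s ts → e ∈ edgesAt p k s ts → f ∈ edgesAt p k s ts →
  Edge.bot e ≡ Edge.top f → Nested ts s (Edge.lo e) (Edge.lo f)
nested-edges p k s (node cs ∷ r) me mf eq with ∈-edgesF-node∷⁻ p k s cs r me | ∈-edgesF-node∷⁻ p k s cs r mf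
... | inj₁ refl | inj₁ refl = ⊥-elim (Below-≢ (Below-child {p} {k}) eq)
... | inj₁ refl | inj₂ (inj₁ m₁) with root-edge-lo (p ++ [ k ]) 0 _ cs m₁ (sym eq)
...   | us , ws , vs , refl , l = hole [] r , us , ws , vs , refl , refl , l
nested-edges p k s (node cs ∷ r) me mf eq | inj₁ refl | inj₂ (inj₂ m₂) =
  ⊥-elim (top-in-later p k _ r m₂ (λ e → Below-≢ Below-child (trans eq e)) (subst (Below p k) eq Below-child))
nested-edges p k s (node cs ∷ r) me mf eq | inj₂ (inj₁ m₁) | inj₁ refl =
  ⊥-elim (Below-≢ (bot-in-child p k _ cs m₁) eq)
nested-edges p k s (node cs ∷ r) me mf eq | inj₂ (inj₁ m₁) | inj₂ (inj₁ m₃)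
  with nested-edges (p ++ [ k ]) 0 (suc s) cs m₁ m₃ eq
... | C , us , ws , vs , refl , l₁ , l₂ = down [] C r , us , ws , vs , refl , l₁ , l₂
nested-edges p k s (node cs ∷ r) me mf eq | inj₂ (inj₁ m₁) | inj₂ (inj₂ m₂) =
  ⊥-elim (top-in-later p k _ r m₂ (λ e → Below-≢ (bot-in-child p k _ cs m₁) (trans eq e))
                                  (subst (Below p k) eq (bot-in-child p k _ cs m₁)))
nested-edges p k s (node cs ∷ r) me mf eq | inj₂ (inj₂ m₂) | inj₁ refl =
  ⊥-elim (Below-≢ (proj₂ (proj₂ (bot-location p (suc k) _ r m₂))) eq)
nested-edges p k s (node cs ∷ r) me mf eq | inj₂ (inj₂ m₂) | inj₂ (inj₁ m₃) =
  ⊥-elim (bot-in-later p k _ r m₂ (subst (Below p k) (sym eq) (top-in-child p k _ cs m₃)))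
nested-edges p k s (node cs ∷ r) me mf eq | inj₂ (inj₂ m₂) | inj₂ (inj₂ m₄) =
  nested-◂ (node cs) (nested-edges p (suc k) _ r m₂ m₄ eq)

edge-in-child-inside : ∀ {e} p k s cs → e ∈ edgesAt (p ++ [ k ]) 0 (suc s) cs →
  Inside (suc s) (afterF (suc s) cs) (labels e)
edge-in-child-inside p k s cs m = pairsF-inside (suc s) cs (labels∈pairsF (p ++ [ k ]) 0 (suc s) cs m)

edge-in-later-lo : ∀ {e} p k s cs r → e ∈ edgesAt p (suc k) (suc (afterF (suc s) cs)) r →
  suc (afterF (suc s) cs) ≤ Edge.lo e
edge-in-later-lo p k s cs r m = proj₁ (pairsF-inside _ r (labels∈pairsF p (suc k) _ r m))

sibling-edges-disjoint : ∀ {e f} p k s ts → e ∈ edgesAt p k s ts → f ∈ edgesAt p k s ts →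
  Edge.top e ≡ Edge.top f → Edge.lo e < Edge.lo f → Edge.hi e < Edge.lo f
sibling-edges-disjoint p k s (node cs ∷ r) me mf eq lt with ∈-edgesF-node∷⁻ p k s cs r me | ∈-edgesF-node∷⁻ p k s cs r mf
... | inj₁ refl      | inj₁ refl      = ⊥-elim (<-irrefl refl lt)
... | inj₁ refl      | inj₂ (inj₁ m₁) = ⊥-elim (Below-≢ (top-in-child p k _ cs m₁) (sym eq))
... | inj₁ refl      | inj₂ (inj₂ m₂) = edge-in-later-lo p k s cs r m₂
... | inj₂ (inj₁ m₁) | inj₁ refl      = ⊥-elim (<⇒≱ lt (≤-trans (n≤1+n s) (proj₁ (edge-in-child-inside p k s cs m₁))))
... | inj₂ (inj₁ m₁) | inj₂ (inj₁ m₃) = sibling-edges-disjoint (p ++ [ k ]) 0 (suc s) cs m₁ m₃ eq lt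
... | inj₂ (inj₁ m₁) | inj₂ (inj₂ m₂) =
  <-trans (proj₂ (proj₂ (edge-in-child-inside p k s cs m₁))) (edge-in-later-lo p k s cs r m₂)
... | inj₂ (inj₂ m₂) | inj₁ refl      =
  ⊥-elim (<⇒≱ lt (≤-trans (<⇒≤ (s<after-node s cs)) (edge-in-later-lo p k s cs r m₂)))
... | inj₂ (inj₂ m₂) | inj₂ (inj₁ m₃) =
  ⊥-elim (top-in-later p k _ r m₂ (λ e → Below-≢ (top-in-child p k _ cs m₃) (trans (sym eq) e))
                                  (subst (Below p k) (sym eq) (top-in-child p k _ cs m₃)))
... | inj₂ (inj₂ m₂) | inj₂ (inj₂ m₄) = sibling-edges-disjoint p (suc k) _ r m₂ m₄ eq lt

bot-determines-lo : ∀ {e f} p k s ts → e ∈ edgesAt p k s ts → f ∈ edgesAt p k s ts →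
  Edge.bot e ≡ Edge.bot f → Edge.lo e ≡ Edge.lo f
bot-determines-lo p k s (node cs ∷ r) me mf eq with ∈-edgesF-node∷⁻ p k s cs r me | ∈-edgesF-node∷⁻ p k s cs r mf
... | inj₁ refl      | inj₁ refl      = refl
... | inj₁ refl      | inj₂ (inj₁ m₁) =
  ⊥-elim (Below-≢ (proj₂ (proj₂ (bot-location (p ++ [ k ]) 0 _ cs m₁))) (sym eq))
... | inj₁ refl      | inj₂ (inj₂ m₂) = ⊥-elim (bot-in-later p k _ r m₂ (subst (Below p k) eq Below-child))
... | inj₂ (inj₁ m₁) | inj₁ refl      =
  ⊥-elim (Below-≢ (proj₂ (proj₂ (bot-location (p ++ [ k ]) 0 _ cs m₁))) eq)
... | inj₂ (inj₁ m₁) | inj₂ (inj₁ m₃) = bot-determines-lo (p ++ [ k ]) 0 (suc s) cs m₁ m₃ eq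
... | inj₂ (inj₁ m₁) | inj₂ (inj₂ m₂) = ⊥-elim (bot-in-later p k _ r m₂ (subst (Below p k) eq (bot-in-child p k _ cs m₁)))
... | inj₂ (inj₂ m₂) | inj₁ refl      = ⊥-elim (bot-in-later p k _ r m₂ (subst (Below p k) (sym eq) Below-child))
... | inj₂ (inj₂ m₂) | inj₂ (inj₁ m₃) =
  ⊥-elim (bot-in-later p k _ r m₂ (subst (Below p k) (sym eq) (bot-in-child p k _ cs m₃)))
... | inj₂ (inj₂ m₂) | inj₂ (inj₂ m₄) = bot-determines-lo p (suc k) _ r m₂ m₄ eq

∈-++[]⁻ : ∀ {x : ℕ × ℕ} A → x ∈ A ++ [] → x ∈ A
∈-++[]⁻ A m with ∈-++⁻ A m
... | inj₁ m₁ = m₁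
... | inj₂ ()

-- The type 2 move replacing e(i,j'), e(j,i') by e(i,j), e(i',j'), where e(i,j') is the
-- edge into node (us ++ node ws ∷ vs) at the hole of C and e(j,i') the edge into node ws.
module Lift (C : Context) (us ws vs : List Tree) where
  before after : List Tree
  before = node (us ++ node ws ∷ vs) ∷ []
  after  = node us ∷ ws ++ node vs ∷ []

  i j i′ j′ : ℕ
  i  = holeStart C 1
  j  = afterF (suc i) us
  i′ = afterF (suc j) ws
  j′ = afterF (suc i′) vs

  i<j : i < j
  i<j = s≤afterF (suc i) us

  j<i′ : j < i′
  j<i′ = s≤afterF (suc j) ws

  i′<j′ : i′ < j′
  i′<j′ = s≤afterF (suc i′) vs

  outer-hi : afterF (suc i) (us ++ node ws ∷ vs) ≡ j′
  outer-hi = afterF-++ (suc i) us (node ws ∷ vs)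

  same-end : afterF i before ≡ afterF i after
  same-end = trans (cong suc outer-hi) (sym (afterF-++ (suc j) ws (node vs ∷ [])))

  Untouched : ℕ × ℕ → Set
  Untouched x = x ∈ pairsF (suc i) us ⊎ x ∈ pairsF (suc j) ws ⊎ x ∈ pairsF (suc i′) vs

  outer∈before : (i , afterF (suc i) (us ++ node ws ∷ vs)) ∈ pairsF i before
  outer∈before = here refl

  inner∈before : (j , i′) ∈ pairsF i before
  inner∈before = there (∈-++⁺ˡ (∈-pairsF-++ʳ (suc i) us (node ws ∷ vs) (here refl)))

  ∈-before⁻ : ∀ {x} → x ∈ pairsF i before → x ≡ (i , j′) ⊎ x ≡ (j , i′) ⊎ Untouched x
  ∈-before⁻ (here e) = inj₁ (trans e (cong (i ,_) outer-hi))
  ∈-before⁻ (there m) with ∈-pairsF-++⁻ (suc i) us (node ws ∷ vs) (∈-++[]⁻ (pairsF (suc i) (us ++ node ws ∷ vs)) m)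
  ... | inj₁ mu       = inj₂ (inj₂ (inj₁ mu))
  ... | inj₂ (here e) = inj₂ (inj₁ e)
  ... | inj₂ (there m₂) = inj₂ (inj₂ (inj₂ (∈-++⁻ (pairsF (suc j) ws) m₂)))

  ∈-before⁺ : ∀ {x} → Untouched x → x ∈ pairsF i before
  ∈-before⁺ (inj₁ mu) = there (∈-++⁺ˡ (∈-pairsF-++ˡ (suc i) us (node ws ∷ vs) mu))
  ∈-before⁺ (inj₂ (inj₁ mw)) = there (∈-++⁺ˡ (∈-pairsF-++ʳ (suc i) us (node ws ∷ vs) (there (∈-++⁺ˡ mw))))
  ∈-before⁺ (inj₂ (inj₂ mv)) =
    there (∈-++⁺ˡ (∈-pairsF-++ʳ (suc i) us (node ws ∷ vs) (there (∈-++⁺ʳ (pairsF (suc j) ws) mv))))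

  ∈-after⁻ : ∀ {x} → x ∈ pairsF i after → x ≡ (i , j) ⊎ x ≡ (i′ , j′) ⊎ Untouched x
  ∈-after⁻ (here e) = inj₁ e
  ∈-after⁻ (there m) with ∈-++⁻ (pairsF (suc i) us) m
  ... | inj₁ mu = inj₂ (inj₂ (inj₁ mu))
  ... | inj₂ m₂ with ∈-pairsF-++⁻ (suc j) ws (node vs ∷ []) m₂
  ...   | inj₁ mw          = inj₂ (inj₂ (inj₂ (inj₁ mw)))
  ...   | inj₂ (here e)    = inj₂ (inj₁ e)
  ...   | inj₂ (there m₃) = inj₂ (inj₂ (inj₂ (inj₂ (∈-++[]⁻ (pairsF (suc i′) vs) m₃))))

  ∈-after⁺ : ∀ {x} → x ≡ (i , j) ⊎ x ≡ (i′ , j′) ⊎ Untouched x → x ∈ pairsF i after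
  ∈-after⁺ (inj₁ e) = here e
  ∈-after⁺ (inj₂ (inj₁ e)) = there (∈-++⁺ʳ (pairsF (suc i) us) (∈-pairsF-++ʳ (suc j) ws (node vs ∷ []) (here e)))
  ∈-after⁺ (inj₂ (inj₂ (inj₁ mu))) = there (∈-++⁺ˡ mu)
  ∈-after⁺ (inj₂ (inj₂ (inj₂ (inj₁ mw)))) =
    there (∈-++⁺ʳ (pairsF (suc i) us) (∈-pairsF-++ˡ (suc j) ws (node vs ∷ []) mw))
  ∈-after⁺ (inj₂ (inj₂ (inj₂ (inj₂ mv)))) =
    there (∈-++⁺ʳ (pairsF (suc i) us) (∈-pairsF-++ʳ (suc j) ws (node vs ∷ []) (there (∈-++⁺ˡ mv))))

  untouched-lo : ∀ {x} → Untouched x → (proj₁ x ≢ i) × (proj₁ x ≢ j)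
  untouched-lo (inj₁ mu) = >⇒≢ (proj₁ (pairsF-inside _ us mu)) , <⇒≢ (lo<end (pairsF-inside _ us mu))
  untouched-lo (inj₂ (inj₁ mw)) = >⇒≢ (<-trans i<j (proj₁ (pairsF-inside _ ws mw))) , >⇒≢ (proj₁ (pairsF-inside _ ws mw))
  untouched-lo (inj₂ (inj₂ mv)) =
    >⇒≢ (<-trans i<j (<-trans j<i′ (proj₁ (pairsF-inside _ vs mv)))) , >⇒≢ (<-trans j<i′ (proj₁ (pairsF-inside _ vs mv)))

  Kept : ℕ × ℕ → Set
  Kept x = (x ∈ pairs (node (plug C before)) × x ≢ (i , j′) × x ≢ (j , i′)) ⊎ x ≡ (i , j) ⊎ x ≡ (i′ , j′)

  j<j′ : j < j′
  j<j′ = <-trans j<i′ i′<j′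

  i<j′ : i < j′
  i<j′ = <-trans i<j j<j′

  lo-outside⇒kept : ∀ {x} → x ∈ pairsF 1 (plug C before) → proj₁ x < i ⊎ afterF i before ≤ proj₁ x → Kept x
  lo-outside⇒kept {x} m lo =
    inj₁ (∈-pairs-node⁺ m , lo≢ i ≤-refl (<⇒≤ i<j′) ∘ cong proj₁ , lo≢ j (<⇒≤ i<j) (<⇒≤ j<j′) ∘ cong proj₁)
    where
      lo≢ : ∀ a → i ≤ a → a ≤ j′ → proj₁ x ≢ a
      lo≢ a i≤a a≤j′ = [ (λ lt → <⇒≢ (<-≤-trans lt i≤a)) ,
                         (λ ge → >⇒≢ (<-≤-trans (s≤s a≤j′) (subst (_≤ proj₁ x) (cong suc outer-hi) ge))) ]′ lo

  after⇒kept : ∀ {x} → x ∈ pairs (node (plug C after)) → Kept x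
  after⇒kept {x} m with ∈-pairsF-plug⁻ C 1 after before (sym same-end) (∈-pairs-node⁻ m)
  ... | inj₂ (m′ , lo) = lo-outside⇒kept m′ (map₂ (≤-trans (≤-reflexive same-end)) lo)
  ... | inj₁ m₂ with ∈-after⁻ m₂
  ...   | inj₁ e          = inj₂ (inj₁ e)
  ...   | inj₂ (inj₁ e)   = inj₂ (inj₂ e)
  ...   | inj₂ (inj₂ unt) = inj₁ (∈-pairs-node⁺ (pairsF-hole⊆pairsF-plug C 1 before (∈-before⁺ unt)) ,
                               (λ e → proj₁ (untouched-lo unt) (cong proj₁ e)) ,
                               (λ e → proj₂ (untouched-lo unt) (cong proj₁ e)))

  kept⇒after : ∀ {x} → Kept x → x ∈ pairs (node (plug C after))
  kept⇒after (inj₂ e) = ∈-pairs-node⁺ (pairsF-hole⊆pairsF-plug C 1 after (∈-after⁺ (map₂ inj₁ e)))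
  kept⇒after (inj₁ (m , ≢ij′ , ≢ji′)) with ∈-pairsF-plug⁻ C 1 before after same-end (∈-pairs-node⁻ m)
  ... | inj₂ (m′ , _) = ∈-pairs-node⁺ m′
  ... | inj₁ m₁ with ∈-before⁻ m₁
  ...   | inj₁ e          = ⊥-elim (≢ij′ e)
  ...   | inj₂ (inj₁ e)   = ⊥-elim (≢ji′ e)
  ...   | inj₂ (inj₂ unt) = ∈-pairs-node⁺ (pairsF-hole⊆pairsF-plug C 1 after (∈-after⁺ (inj₂ (inj₂ unt))))

  parent child : Vertex
  parent = proj₁ (holeAddress C [] 0)
  child  = parent ++ [ proj₂ (holeAddress C [] 0) ]

  outer-edge : edge i (afterF (suc i) (us ++ node ws ∷ vs)) parent child ∈ edgesAt [] 0 1 (plug C before)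
  outer-edge = edgesF-hole⊆edgesF-plug C [] 0 1 before (∈-edgesF-head parent _ i (us ++ node ws ∷ vs) [])

  inner-edge : edge j i′ child (child ++ [ 0 + length us ]) ∈ edgesAt [] 0 1 (plug C before)
  inner-edge = edgesF-hole⊆edgesF-plug C [] 0 1 before
    (∈-edgesF-child parent _ i (us ++ node ws ∷ vs) []
      (∈-edgesF-++ʳ child 0 (suc i) us (node ws ∷ vs) (∈-edgesF-head child (0 + length us) j ws vs)))

  totalDist-< : totalDist (node (plug C after)) < totalDist (node (plug C before))
  totalDist-< = distSumF-plug-< C before after (distSumF-lift-< us ws vs) 1

-- The greedy algorithm along the contour walk

infix 4 _≐_
_≐_ : List (ℕ × ℕ) → List (ℕ × ℕ) → Set
A ≐ B = ∀ x → (x ∈ A → x ∈ B) × (x ∈ B → x ∈ A)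

≐-reflexive : ∀ {A B} → A ≡ B → A ≐ B
≐-reflexive refl x = (λ m → m) , (λ m → m)

≐-trans : ∀ {A B D} → A ≐ B → B ≐ D → A ≐ D
≐-trans A≐B B≐D x = (λ m → proj₁ (B≐D x) (proj₁ (A≐B x) m)) , (λ m → proj₂ (A≐B x) (proj₂ (B≐D x) m))

≐-splice : ∀ {X A Y Z B R} h → X ≐ A ++ Y → Y ≡ h ∷ Z → Z ≐ B ++ R → X ≐ (h ∷ (A ++ B)) ++ R
≐-splice {X} {A} {Y} {Z} {B} {R} h X≐ refl Z≐ x = to , from
  where
    to : x ∈ X → x ∈ (h ∷ (A ++ B)) ++ R
    to m with ∈-++⁻ A (proj₁ (X≐ x) m)
    ... | inj₁ ma = there (∈-++⁺ˡ (∈-++⁺ˡ ma))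
    ... | inj₂ (here e) = here e
    ... | inj₂ (there mz) with ∈-++⁻ B (proj₁ (Z≐ x) mz)
    ...   | inj₁ mb = there (∈-++⁺ˡ (∈-++⁺ʳ A mb))
    ...   | inj₂ mr = there (∈-++⁺ʳ (A ++ B) mr)
    from : x ∈ (h ∷ (A ++ B)) ++ R → x ∈ X
    from (here e) = proj₂ (X≐ x) (∈-++⁺ʳ A (here e))
    from (there m) with ∈-++⁻ (A ++ B) m
    ... | inj₂ mr = proj₂ (X≐ x) (∈-++⁺ʳ A (there (proj₂ (Z≐ x) (∈-++⁺ʳ B mr))))
    ... | inj₁ mab with ∈-++⁻ A mab
    ...   | inj₁ ma = proj₂ (X≐ x) (∈-++⁺ˡ ma)
    ...   | inj₂ mb = proj₂ (X≐ x) (∈-++⁺ʳ A (there (proj₂ (Z≐ x) (∈-++⁺ˡ mb))))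

drop-≥length : ∀ {A : Set} m (xs : List A) → length xs ≤ m → drop m xs ≡ []
drop-≥length m       []       _         = drop-[] m
drop-≥length (suc m) (x ∷ xs) (s≤s le) = drop-≥length m xs le

module Greedy (𝒜 : ComplementaryAlphabet) where
  open ComplementaryAlphabet 𝒜

  ComplAt : List Carrier → ℕ × ℕ → Set
  ComplAt P (i , j) = Compl 𝒜 (at 𝒜 P i) (at 𝒜 P j)

  compl⇒letters : ∀ P a b → ComplAt P (a , b) →
    Σ Carrier λ x → Σ Carrier λ y → (at 𝒜 P a ≡ just x) × (at 𝒜 P b ≡ just y) × (y ≡ comp x)
  compl⇒letters P a b c with at 𝒜 P a | at 𝒜 P b
  ... | just x  | just y = x , y , refl , refl , c

  letters⇒compl : ∀ P a b {x y} → at 𝒜 P a ≡ just x → at 𝒜 P b ≡ just y → y ≡ comp x → ComplAt P (a , b)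
  letters⇒compl P a b eqa eqb c rewrite eqa | eqb = c

  -- Complementation is an involution, so being complementary is transferred along a zigzag.
  compl-zigzag : ∀ {a b c d} → Compl 𝒜 a d → Compl 𝒜 a b → Compl 𝒜 b c → Compl 𝒜 c d
  compl-zigzag {just a} {just b} {just c} {just d} refl refl refl = cong comp (sym (comp-invol a))

  at-drop : ∀ (P : List Carrier) i {x} → 1 ≤ i → at 𝒜 P i ≡ just x → drop (i ∸ 1) P ≡ x ∷ drop i P
  at-drop (y ∷ ys) (suc zero)    _ refl = refl
  at-drop (y ∷ ys) (suc (suc i)) _ eq   = at-drop ys (suc i) (s≤s z≤n) eq

  -- Positions are 1-based, so the greedy run resumed at position i reads drop (i ∸ 1) P.
  greedyAt : List Carrier → ℕ → List ℕ → List (ℕ × ℕ)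
  greedyAt P i st = greedyFrom 𝒜 P (drop (i ∸ 1) P) i st

  greedy-match : ∀ P x xs i j st y → at 𝒜 P j ≡ just y → x ≡ comp y →
    greedyFrom 𝒜 P (x ∷ xs) i (j ∷ st) ≡ (j , i) ∷ greedyFrom 𝒜 P xs (suc i) st
  greedy-match P x xs i j st y eq c rewrite eq with compl? 𝒜 y x
  ... | yes _ = refl
  ... | no ¬c = ⊥-elim (¬c c)

  greedy-match-or-push : ∀ P x xs i st →
    (Σ ℕ λ j → Σ (List ℕ) λ st′ → Σ Carrier λ y → (st ≡ j ∷ st′) × (at 𝒜 P j ≡ just y) × (x ≡ comp y)) ⊎
    (greedyFrom 𝒜 P (x ∷ xs) i st ≡ greedyFrom 𝒜 P xs (suc i) (i ∷ st))
  greedy-match-or-push P x xs i []       = inj₂ refl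
  greedy-match-or-push P x xs i (j ∷ st) with at 𝒜 P j in eq
  ... | nothing = inj₂ refl
  ... | just y with compl? 𝒜 y x
  ...   | yes c = inj₁ (j , st , y , refl , eq , c)
  ...   | no _  = inj₂ refl

  StackMatch : List Carrier → List Tree → ℕ → List ℕ → Set
  StackMatch P ts s st = Σ ℕ λ j → Σ (List ℕ) λ st′ → Σ (List Tree) λ us → Σ (List Tree) λ ws → Σ (List Tree) λ vs →
    (st ≡ j ∷ st′) × (ts ≡ us ++ node ws ∷ vs) × ComplAt P (j , afterF s us)

  Liftable : List Carrier → List Tree → ℕ → Set
  Liftable P ts s = Σ ℕ λ i → Σ ℕ λ j → Nested ts s i j × ComplAt P (i , j)

  stackMatch-◂ : ∀ {P ts s st} t → StackMatch P ts (suc (afterT (suc s) t)) st → StackMatch P (t ∷ ts) s st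
  stackMatch-◂ t (j , st′ , us , ws , vs , eq , refl , c) = j , st′ , t ∷ us , ws , vs , eq , refl , c

  liftable-◂ : ∀ {P ts s} t → Liftable P ts (suc (afterT (suc s) t)) → Liftable P (t ∷ ts) s
  liftable-◂ t (i , j , nested , c) = i , j , nested-◂ t nested , c

  liftable-down : ∀ {P cs s} ts → Liftable P cs (suc s) → Liftable P (node cs ∷ ts) s
  liftable-down ts (i , j , (C , us , ws , vs , refl , eqi , eqj) , c) =
    i , j , (down [] C ts , us , ws , vs , refl , eqi , eqj) , c

  -- A stack match inside a child forest, against the position that opened its parent edge.
  stackMatch⇒liftable : ∀ {P cs s st} ts → StackMatch P cs (suc s) (s ∷ st) → Liftable P (node cs ∷ ts) s
  stackMatch⇒liftable ts (_ , _ , us , ws , vs , refl , refl , c) =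
    _ , _ , (hole [] ts , us , ws , vs , refl , refl , refl) , c

  greedy-simulates : ∀ P ts s st → 1 ≤ s → (∀ {x} → x ∈ pairsF s ts → ComplAt P x) →
    greedyAt P s st ≐ pairsF s ts ++ greedyAt P (afterF s ts) st ⊎ StackMatch P ts s st ⊎ Liftable P ts s
  greedy-simulates P [] s st _ _ = inj₁ (≐-reflexive refl)
  greedy-simulates P (node cs ∷ ts) s st 1≤s compl
    with compl⇒letters P s (afterF (suc s) cs) (compl (here refl))
  ... | x , z , at-s , at-b , z≡ with greedy-match-or-push P x (drop s P) s st
  ...   | inj₁ (j , st′ , y , refl , at-j , x≡) =
    inj₂ (inj₁ (j , st′ , [] , cs , ts , refl , refl , letters⇒compl P j s at-j at-s x≡))
  ...   | inj₂ push with greedy-simulates P cs (suc s) (s ∷ st) (s≤s z≤n) (λ m → compl (there (∈-++⁺ˡ m)))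
  ...     | inj₂ (inj₁ sm) = inj₂ (inj₂ (stackMatch⇒liftable {P = P} ts sm))
  ...     | inj₂ (inj₂ l)  = inj₂ (inj₂ (liftable-down {P = P} ts l))
  ...     | inj₁ inner with greedy-simulates P ts (suc (afterF (suc s) cs)) st (s≤s z≤n)
                              (λ m → compl (there (∈-++⁺ʳ (pairsF (suc s) cs) m)))
  ...       | inj₂ (inj₁ sm) = inj₂ (inj₁ (stackMatch-◂ {P = P} (node cs) sm))
  ...       | inj₂ (inj₂ l)  = inj₂ (inj₂ (liftable-◂ {P = P} (node cs) l))
  ...       | inj₁ rest      = inj₁ (≐-trans (≐-reflexive push-s) (≐-splice (s , b) inner match-b rest))
    where
      b = afterF (suc s) cs
      push-s : greedyAt P s st ≡ greedyAt P (suc s) (s ∷ st)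
      push-s = trans (cong (λ w → greedyFrom 𝒜 P w s st) (at-drop P s 1≤s at-s)) push
      s≤b : s ≤ b
      s≤b = ≤-trans (n≤1+n s) (s≤afterF (suc s) cs)
      match-b : greedyAt P b (s ∷ st) ≡ (s , b) ∷ greedyAt P (suc b) st
      match-b = trans (cong (λ w → greedyFrom 𝒜 P w b (s ∷ st)) (at-drop P b (≤-trans 1≤s s≤b) at-b))
                      (greedy-match P z _ b s st x at-s z≡)

  pairs-compl : ∀ n P ts → Valid 𝒜 n P (node ts) → ∀ {x} → x ∈ pairsF 1 ts → ComplAt P x
  pairs-compl n P ts (_ , compl) m with ∈-map⁻ labels (∈-pairs-node⁺ {ts} m)
  ... | e , me , refl = compl e me

  numEdges-node : ∀ ts → numEdges (node ts) ≡ length (pairsF 1 ts)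
  numEdges-node ts = trans (sym (length-map labels (edges (node ts)))) (cong length (pairs-node ts))

  Descent : ℕ → List Carrier → Tree → Set
  Descent n P T = Σ Tree λ T′ → Move₂ 𝒜 n P T T′ × (totalDist T′ < totalDist T)

  lift-move : ∀ n P C us ws vs → let open Lift C us ws vs in
    Valid 𝒜 n P (node (plug C before)) → ComplAt P (i , j) → Descent n P (node (plug C before))
  lift-move n P C us ws vs valid c[i,j] =
    node (plug C after) ,
    (valid , valid′ , _ , _ , i , j , i′ , j′ , i<j , j<i′ , i′<j′ , outer-edge , inner-edge ,
     refl , outer-hi , refl , refl , inj₂ (inj₂ (inj₁ refl)) , λ x → after⇒kept , kept⇒after) ,
    totalDist-<
    where
      open Lift C us ws vs
      compl-before = pairs-compl n P (plug C before) valid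
      c[i,j′] : ComplAt P (i , j′)
      c[i,j′] = subst (λ z → ComplAt P (i , z)) outer-hi
                  (compl-before (pairsF-hole⊆pairsF-plug C 1 before outer∈before))
      c[j,i′] : ComplAt P (j , i′)
      c[j,i′] = compl-before (pairsF-hole⊆pairsF-plug C 1 before inner∈before)
      kept-compl : ∀ {x} → Kept x → ComplAt P x
      kept-compl (inj₁ (m , _ , _))  = compl-before (∈-pairs-node⁻ m)
      kept-compl (inj₂ (inj₁ refl)) = c[i,j]
      kept-compl (inj₂ (inj₂ refl)) = compl-zigzag {at 𝒜 P i} c[i,j′] c[i,j] c[j,i′]
      valid′ : Valid 𝒜 n P (node (plug C after))
      valid′ = trans (numEdges-node (plug C after))
                 (trans (length-pairsF-plug C before after same-end) (trans (sym (numEdges-node (plug C before))) (proj₁ valid))) ,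
               λ e me → kept-compl (after⇒kept (∈-map⁺ labels me))

  nested⇒descent : ∀ n P {ts i j} → Valid 𝒜 n P (node ts) → Nested ts 1 i j → ComplAt P (i , j) → Descent n P (node ts)
  nested⇒descent n P valid (C , us , ws , vs , refl , refl , refl) c = lift-move n P C us ws vs valid c

  descent⇒¬minDist : ∀ n P T → Descent n P T → ¬ IsMinDist 𝒜 n P T
  descent⇒¬minDist n P T (T′ , move , lt) min = <⇒≱ lt (min T′ (proj₁ (proj₂ move)))

  greedy-exhausted : ∀ n P ts → length P ≡ 2 * n → Valid 𝒜 n P (node ts) → greedyAt P (afterF 1 ts) [] ≡ []
  greedy-exhausted n P ts len valid = cong (λ w → greedyFrom 𝒜 P w _ []) (drop-≥length _ P (≤-reflexive length≡))
    where
      open ≡-Reasoning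
      L = length (pairsF 1 ts)
      length≡ : length P ≡ afterF 1 ts ∸ 1
      length≡ = begin
        length P        ≡⟨ len ⟩
        2 * n           ≡⟨ cong (2 *_) (trans (sym (proj₁ valid)) (numEdges-node ts)) ⟩
        L + (L + 0)     ≡⟨ cong (L +_) (+-identityʳ L) ⟩
        L + L           ≡⟨ m+n∸n≡m (L + L) 1 ⟨
        L + L + 1 ∸ 1   ≡⟨ cong (_∸ 1) (afterF-size 1 ts) ⟨
        afterF 1 ts ∸ 1 ∎

  greedy⊎descent : ∀ n P → length P ≡ 2 * n → ∀ T → Valid 𝒜 n P T → IsGreedyTree 𝒜 P T ⊎ Descent n P T
  greedy⊎descent n P len (node ts) valid with greedy-simulates P ts 1 [] (s≤s z≤n) (pairs-compl n P ts valid)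
  ... | inj₂ (inj₁ (_ , _ , _ , _ , _ , () , _))
  ... | inj₂ (inj₂ (_ , _ , nested , c)) = inj₂ (nested⇒descent n P valid nested c)
  ... | inj₁ sim = inj₁ λ x → (λ m → proj₂ (sim x) (∈-++⁺ˡ (∈-pairs-node⁻ {ts} m))) , from x
    where
      from : ∀ x → x ∈ greedy 𝒜 P → x ∈ pairs (node ts)
      from x m with ∈-++⁻ (pairsF 1 ts) (proj₁ (sim x) m)
      ... | inj₁ m₁ = ∈-pairs-node⁺ m₁
      ... | inj₂ m₂ with subst (x ∈_) (greedy-exhausted n P ts len valid) m₂
      ...   | ()

  greedy-below : ∀ n P → length P ≡ 2 * n → ∀ T → Valid 𝒜 n P T →
    Σ Tree λ G → IsGreedyTree 𝒜 P G × (totalDist G ≤ totalDist T)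
  greedy-below n P len T = descend (suc (totalDist T)) T ≤-refl
    where
      descend : ∀ fuel T → totalDist T < fuel → Valid 𝒜 n P T →
        Σ Tree λ G → IsGreedyTree 𝒜 P G × (totalDist G ≤ totalDist T)
      descend (suc fuel) T lt valid with greedy⊎descent n P len T valid
      ... | inj₁ g = T , g , ≤-refl
      ... | inj₂ (T′ , move , lt′) with descend fuel T′ (<-≤-trans lt′ (≤-pred lt)) (proj₁ (proj₂ move))
      ...   | G , g , le = G , g , ≤-trans le (<⇒≤ lt′)

  greedy-unique : ∀ P T₁ T₂ → IsGreedyTree 𝒜 P T₁ → IsGreedyTree 𝒜 P T₂ → T₁ ≡ T₂
  greedy-unique P (node ts₁) (node ts₂) g₁ g₂ = cong node (pairsF-injective 1 ts₁ ts₂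
    (λ {x} m → ∈-pairs-node⁻ (proj₂ (g₂ x) (proj₁ (g₁ x) (∈-pairs-node⁺ m))))
    (λ {x} m → ∈-pairs-node⁻ (proj₂ (g₁ x) (proj₁ (g₂ x) (∈-pairs-node⁺ m)))))

  greedy⇒minDist : ∀ n P → length P ≡ 2 * n → ∀ T → IsGreedyTree 𝒜 P T → IsMinDist 𝒜 n P T
  greedy⇒minDist n P len T g T′ valid′ with greedy-below n P len T′ valid′
  ... | G , gG , le = subst (λ z → totalDist z ≤ totalDist T′) (greedy-unique P G T gG g) le

  minDist⇒greedy : ∀ n P → length P ≡ 2 * n → ∀ T → Valid 𝒜 n P T → IsMinDist 𝒜 n P T → IsGreedyTree 𝒜 P T
  minDist⇒greedy n P len T valid min with greedy⊎descent n P len T valid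
  ... | inj₁ g = g
  ... | inj₂ d = ⊥-elim (descent⇒¬minDist n P T d min)

  sink⇒greedy : ∀ n P → length P ≡ 2 * n → ∀ T → IsSink 𝒜 n P T → IsGreedyTree 𝒜 P T
  sink⇒greedy n P len T (valid , no-move) with greedy⊎descent n P len T valid
  ... | inj₁ g = g
  ... | inj₂ (T′ , move , _) = ⊥-elim (no-move T′ move)

  -- Of the four ways two edges can share a vertex, only e(j,i') hanging below e(i,j') is
  -- compatible with i < j < i' < j', and then the move is a lift, which cannot start
  -- from a tree of minimum total distance.
  greedy⇒no-move : ∀ n P → length P ≡ 2 * n → ∀ T → IsGreedyTree 𝒜 P T → ∀ T′ → ¬ Move₂ 𝒜 n P T T′
  greedy⇒no-move n P len (node ts) g T′
    (valid , valid′ , e₁ , e₂ , _ , _ , _ , _ , i<j , j<i′ , i′<j′ , e₁∈ , e₂∈ , refl , refl , refl , refl , shared , kept)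
    with shared
  ... | inj₁ top≡top =
    <-asym (<-trans j<i′ i′<j′) (sibling-edges-disjoint [] 0 1 ts e₁∈ e₂∈ top≡top i<j)
  ... | inj₂ (inj₁ top≡bot) = <-asym i<j (nested-lo< (nested-edges [] 0 1 ts e₂∈ e₁∈ (sym top≡bot)))
  ... | inj₂ (inj₂ (inj₂ bot≡bot)) = <-irrefl (bot-determines-lo [] 0 1 ts e₁∈ e₂∈ bot≡bot) i<j
  ... | inj₂ (inj₂ (inj₁ bot≡top)) =
    descent⇒¬minDist n P (node ts) (nested⇒descent n P valid (nested-edges [] 0 1 ts e₁∈ e₂∈ bot≡top) c[i,j])
                     (greedy⇒minDist n P len (node ts) g)
    where
      c[i,j] : ComplAt P (Edge.lo e₁ , Edge.lo e₂)
      c[i,j] with ∈-map⁻ labels (proj₂ (kept _) (inj₂ (inj₁ refl)))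
      ... | e , e∈ , eq = subst (ComplAt P) (sym eq) (proj₂ valid′ e e∈)

open Greedy using (greedy-unique; greedy⇒minDist; minDist⇒greedy; sink⇒greedy; greedy⇒no-move)
open ComplementaryAlphabet using (Carrier)

mainTheorem6 : (𝒜 : ComplementaryAlphabet) (n : ℕ) (P : List (Carrier 𝒜)) →
    length P ≡ 2 * n →
    Σ Tree (Valid 𝒜 n P) →
    (T : Tree) → Valid 𝒜 n P T →
      ((IsUniqueSink 𝒜 n P T ⇔ IsGreedyTree 𝒜 P T) ×
       (IsGreedyTree 𝒜 P T ⇔ IsMinDist 𝒜 n P T))
mainTheorem6 𝒜 n P len _ T valid =
  mk⇔ (λ (sink , _) → sink⇒greedy 𝒜 n P len T sink)
      (λ g → (valid , greedy⇒no-move 𝒜 n P len T g) ,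
             λ T′ sink′ → greedy-unique 𝒜 P T′ T (sink⇒greedy 𝒜 n P len T′ sink′) g) ,
  mk⇔ (greedy⇒minDist 𝒜 n P len T) (minDist⇒greedy 𝒜 n P len T valid)
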